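{- For all positive integers $n_1,n_2$, the complement $\overline{H_{1,2n_1,2n_2}}$ is a comparability graph if and only if $H_{1,2n_1,2n_2}$ has no induced subgraph isomorphic to $G_3$.
   Context: A comparability graph is a graph admitting a transitive orientation (a transitive digraph obtained by orienting each edge in exactly one direction). $\overline{G}$ is the complement of $G$. For $n\ge0$, $t_n(p)=p+n$ and $t_n(G)$ shifts vertices by $n$. Put $s_2=n_1+n_2$. - $G_{2n}$: graph on $\{0,\ldots,2n-1\}$, edges $\{2i,2j+1\}$, $0\le i\le j\le n-1$; $G'_{2n}$: edges $E(G_{2n})\cup\{\{2p-1,2q-1\}:1\le p<q\le n\}$. - $H_{1,2n_1,2n_2}$: graph on $\{0,\ldots,2s_2\}$ with edges $E(t_1(G'_{2n_1}))\cup E(t_{2n_1+1}(G'_{2n_2}))\cup\{\{2p,2q\}:0\le p<q\le s_2\}$. - $G_3$: the graph on 7 vertices $a,b,c,d,x,y,z$ whose edges are all six pairs among $\{a,b,c,d\}$ together with $\{x,a\},\{x,d\},\{y,a\},\{y,b\},\{z,b\},\{z,c\}$. -}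

module Defs where

open import Level using (Level; _⊔_) renaming (suc to lsuc; zero to lzero)
open import Data.Nat using (ℕ; zero; suc; _+_; _*_; _≤_; _<_)
open import Data.Fin using (Fin; toℕ)
open import Data.Product using (Σ; ∃; _×_; _,_)
open import Data.Sum using (_⊎_)
open import Relation.Nullary using (¬_)
open import Relation.Binary.PropositionalEquality using (_≡_)
open import Function.Definitions using (Injective)
open import Function.Bundles using (_⇔_)

Graph : ℕ → Set₁
Graph N = Fin N → Fin N → Set

complement : ∀ {N} → Graph N → Graph N
complement G u v = ¬ (u ≡ v) × ¬ G u v

record TransitiveOrientation {N : ℕ} (G : Graph N) (O : Fin N → Fin N → Set) : Set where
  field
    arc⇒edge   : ∀ u v → O u v → G u v
    edge⇒arc   : ∀ u v → G u v → O u v ⊎ O v u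
    oneWay     : ∀ u v → O u v → ¬ O v u
    transitive : ∀ u v w → O u v → O v w → O u w

IsComparability : ∀ {N} → Graph N → Set₁
IsComparability {N} G = Σ (Fin N → Fin N → Set) λ O → TransitiveOrientation G O

HasInducedCopy : ∀ {M N} → Graph M → Graph N → Set
HasInducedCopy {M} {N} K G =
  Σ (Fin M → Fin N) λ f → Injective _≡_ _≡_ f × (∀ x y → K x y ⇔ G (f x) (f y))

-- Edge relations on ℕ (as ordered pairs; graphs use both orders)

EdgeG : ℕ → ℕ → ℕ → Set
EdgeG n u v = ∃ λ i → ∃ λ j → i ≤ j × j < n × u ≡ 2 * i × v ≡ 2 * j + 1

-- additional edges of G'_{2n}: {2p-1, 2q-1}, 1 ≤ p < q ≤ n  (written with p = p'+1)
EdgeOddClique : ℕ → ℕ → ℕ → Set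
EdgeOddClique n u v = ∃ λ p → ∃ λ q → p < q × q < n × u ≡ 2 * p + 1 × v ≡ 2 * q + 1

EdgeG' : ℕ → ℕ → ℕ → Set
EdgeG' n u v = EdgeG n u v ⊎ EdgeOddClique n u v

shift : ℕ → (ℕ → ℕ → Set) → ℕ → ℕ → Set
shift k E u v = ∃ λ u' → ∃ λ v' → u ≡ k + u' × v ≡ k + v' × E u' v'

EdgeEven : ℕ → ℕ → ℕ → Set
EdgeEven s u v = ∃ λ p → ∃ λ q → p < q × q ≤ s × u ≡ 2 * p × v ≡ 2 * q

EdgeH : ℕ → ℕ → ℕ → ℕ → Set
EdgeH n₁ n₂ u v =
  shift 1 (EdgeG' n₁) u v ⊎ shift (2 * n₁ + 1) (EdgeG' n₂) u v ⊎ EdgeEven (n₁ + n₂) u v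

H : (n₁ n₂ : ℕ) → Graph (2 * (n₁ + n₂) + 1)
H n₁ n₂ u v = EdgeH n₁ n₂ (toℕ u) (toℕ v) ⊎ EdgeH n₁ n₂ (toℕ v) (toℕ u)

-- G₃ on 7 vertices: a=0, b=1, c=2, d=3, x=4, y=5, z=6

data EdgeG₃ : ℕ → ℕ → Set where
  ab : EdgeG₃ 0 1
  ac : EdgeG₃ 0 2
  ad : EdgeG₃ 0 3
  bc : EdgeG₃ 1 2
  bd : EdgeG₃ 1 3
  cd : EdgeG₃ 2 3
  xa : EdgeG₃ 4 0
  xd : EdgeG₃ 4 3
  ya : EdgeG₃ 5 0
  yb : EdgeG₃ 5 1
  zb : EdgeG₃ 6 1
  zc : EdgeG₃ 6 2

G₃ : Graph 7
G₃ u v = EdgeG₃ (toℕ u) (toℕ v) ⊎ EdgeG₃ (toℕ v) (toℕ u)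

-- Both sides of the equivalence hold.
-- In H the odd vertices are pairwise non-adjacent, the even vertices pairwise
-- adjacent, and within each shifted copy of G' the neighbourhood of the odd
-- vertex 2a+1 shrinks as a grows. So orienting every edge of the complement
-- upwards is transitive for a height placing the odd vertices of the second
-- copy below the even vertices and those of the first copy above them.
-- Conversely, transitive orientations restrict to induced subgraphs, and the
-- complement of G₃ has none: orienting x → y forces c → y → z, yet c and z are
-- not adjacent there.
{-# OPTIONS --safe #-}
module Submission where

open import Defs
open import Data.Nat using (ℕ; suc; _+_; _*_; _∸_; _≤_; _<_; _<?_; s≤s; s<s⁻¹)
open import Data.Nat.Properties
open import Data.Nat.Tactic.RingSolver using (solve-∀)
open import Data.Fin using (Fin; toℕ; #_)
open import Data.Fin.Properties using (toℕ<n; toℕ-injective)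
open import Data.Product using (∃; _×_; _,_; proj₁; proj₂)
open import Data.Sum using (_⊎_; inj₁; inj₂)
open import Function using (_∘_; flip)
open import Function.Bundles using (_⇔_; mk⇔; Equivalence)
open import Relation.Nullary using (¬_; contradiction; yes; no)
open import Relation.Binary using (tri<; tri≈; tri>)
open import Relation.Binary.PropositionalEquality using (_≡_; _≢_; refl; sym; trans; cong; subst; ≢-sym)

module _ {N : ℕ} {G : Graph N} {O : Fin N → Fin N → Set}
         (t : TransitiveOrientation G O) where
  open TransitiveOrientation t

  forced-head : ∀ {u v w} → O u v → G v w → ¬ G u w → O w v
  forced-head {u} {v} {w} u→v v—w u≁w with edge⇒arc v w v—w
  ... | inj₁ v→w = contradiction (arc⇒edge u w (transitive u v w u→v v→w)) u≁w
  ... | inj₂ w→v = w→v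

  forced-tail : ∀ {u v w} → O v u → G v w → ¬ G w u → O v w
  forced-tail {u} {v} {w} v→u v—w w≁u with edge⇒arc v w v—w
  ... | inj₁ v→w = v→w
  ... | inj₂ w→v = contradiction (arc⇒edge w u (transitive w v u w→v v→u)) w≁u

  reverse : (∀ {u v} → G u v → G v u) → TransitiveOrientation G (flip O)
  reverse symmetric = record
    { arc⇒edge   = λ u v → symmetric ∘ arc⇒edge v u
    ; edge⇒arc   = λ u v → edge⇒arc v u ∘ symmetric
    ; oneWay     = λ u v → oneWay v u
    ; transitive = λ u v w u←v v←w → transitive w v u v←w u←v
    }

complement-symmetric : ∀ {N} {G : Graph N} → (∀ {u v} → G u v → G v u) →
                       ∀ {u v} → complement G u v → complement G v u
complement-symmetric symmetric (u≢v , u≁v) = ≢-sym u≢v , u≁v ∘ symmetric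

isComparability-byHeight :
  ∀ {N} (C : Graph N) → (∀ {u v} → C u v → C v u) → (h : Fin N → ℕ) →
  (∀ {u v} → C u v → h u ≢ h v) →
  (∀ {u v w} → C u v → C v w → h u < h v → h v < h w → C u w) →
  IsComparability C
isComparability-byHeight {N} C symmetric h separates transitive = Up , record
  { arc⇒edge   = λ _ _ → proj₁
  ; edge⇒arc   = edge⇒arc
  ; oneWay     = λ _ _ u↑v v↑u → <-asym (proj₂ u↑v) (proj₂ v↑u)
  ; transitive = λ _ _ _ (u—v , hu<hv) (v—w , hv<hw) →
      transitive u—v v—w hu<hv hv<hw , <-trans hu<hv hv<hw
  }
  where
  Up : Fin N → Fin N → Set
  Up u v = C u v × h u < h v

  edge⇒arc : ∀ u v → C u v → Up u v ⊎ Up v u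
  edge⇒arc u v u—v with <-cmp (h u) (h v)
  ... | tri< hu<hv _ _ = inj₁ (u—v , hu<hv)
  ... | tri≈ _ hu≡hv _ = contradiction hu≡hv (separates u—v)
  ... | tri> _ _ hv<hu = inj₂ (symmetric u—v , hv<hu)

isComparability-complement-induced :
  ∀ {M N} {K : Graph M} {G : Graph N} →
  HasInducedCopy K G → IsComparability (complement G) → IsComparability (complement K)
isComparability-complement-induced {K = K} {G} (f , f-injective , K⇔G) (O , t) =
  (λ u v → O (f u) (f v)) , record
    { arc⇒edge   = λ u v → reflect ∘ arc⇒edge (f u) (f v)
    ; edge⇒arc   = λ u v → edge⇒arc (f u) (f v) ∘ preserve
    ; oneWay     = λ u v → oneWay (f u) (f v)
    ; transitive = λ u v w → transitive (f u) (f v) (f w)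
    }
  where
  open TransitiveOrientation t

  preserve : ∀ {u v} → complement K u v → complement G (f u) (f v)
  preserve {u} {v} (u≢v , u≁v) = u≢v ∘ f-injective , u≁v ∘ Equivalence.from (K⇔G u v)

  reflect : ∀ {u v} → complement G (f u) (f v) → complement K u v
  reflect {u} {v} (fu≢fv , fu≁fv) = fu≢fv ∘ cong f , fu≁fv ∘ Equivalence.to (K⇔G u v)

module ComplementOfG₃ where
  a b c d x y z : Fin 7
  a = # 0
  b = # 1
  c = # 2
  d = # 3
  x = # 4
  y = # 5
  z = # 6

  G₃ᶜ : Graph 7
  G₃ᶜ = complement G₃

  G₃-symmetric : ∀ {u v} → G₃ u v → G₃ v u
  G₃-symmetric (inj₁ e) = inj₂ e
  G₃-symmetric (inj₂ e) = inj₁ e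

  nonEdge : ∀ {u v} → G₃ u v → ¬ G₃ᶜ u v
  nonEdge u—v (_ , u≁v) = u≁v u—v

  x—y : G₃ᶜ x y
  x—y = (λ ()) , λ { (inj₁ ()) ; (inj₂ ()) }
  x—b : G₃ᶜ x b
  x—b = (λ ()) , λ { (inj₁ ()) ; (inj₂ ()) }
  x—z : G₃ᶜ x z
  x—z = (λ ()) , λ { (inj₁ ()) ; (inj₂ ()) }
  y—d : G₃ᶜ y d
  y—d = (λ ()) , λ { (inj₁ ()) ; (inj₂ ()) }
  y—c : G₃ᶜ y c
  y—c = (λ ()) , λ { (inj₁ ()) ; (inj₂ ()) }
  z—a : G₃ᶜ z a
  z—a = (λ ()) , λ { (inj₁ ()) ; (inj₂ ()) }
  z—y : G₃ᶜ z y
  z—y = (λ ()) , λ { (inj₁ ()) ; (inj₂ ()) }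

  ¬arc-xy : ∀ {O} → TransitiveOrientation G₃ᶜ O → ¬ O x y
  ¬arc-xy {O} t x→y = nonEdge (inj₂ zc) (arc⇒edge c z (transitive c y z c→y y→z))
    where
    open TransitiveOrientation t
    x→b : O x b
    x→b = forced-tail t x→y x—b (nonEdge (inj₂ yb))
    x→z : O x z
    x→z = forced-tail t x→b x—z (nonEdge (inj₁ zb))
    d→y : O d y
    d→y = forced-head t x→y y—d (nonEdge (inj₁ xd))
    c→y : O c y
    c→y = forced-head t d→y y—c (nonEdge (inj₂ cd))
    a→z : O a z
    a→z = forced-head t x→z z—a (nonEdge (inj₁ xa))
    y→z : O y z
    y→z = forced-head t a→z z—y (nonEdge (inj₂ ya))

  ¬isComparability-complement-G₃ : ¬ IsComparability G₃ᶜ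
  ¬isComparability-complement-G₃ (O , t) with TransitiveOrientation.edge⇒arc t x y x—y
  ... | inj₁ x→y = ¬arc-xy t x→y
  ... | inj₂ y→x = ¬arc-xy (reverse t (complement-symmetric G₃-symmetric)) y→x

open ComplementOfG₃ using (¬isComparability-complement-G₃)

isComparability-complement⇒¬G₃ : ∀ {N} {G : Graph N} →
  IsComparability (complement G) → ¬ HasInducedCopy G₃ G
isComparability-complement⇒¬G₃ comparable copy =
  ¬isComparability-complement-G₃ (isComparability-complement-induced copy comparable)

2[1+a]≡2+2a : ∀ a → 2 * suc a ≡ suc (suc (2 * a))
2[1+a]≡2+2a = solve-∀

data EvenOdd : ℕ → Set where
  even : ∀ m → EvenOdd (2 * m)
  odd  : ∀ a → EvenOdd (suc (2 * a))

evenOdd : ∀ v → EvenOdd v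
evenOdd 0 = even 0
evenOdd (suc v) with evenOdd v
... | even m = odd m
... | odd a  = subst EvenOdd (2[1+a]≡2+2a a) (even (suc a))

2*-injective : ∀ {p q} → 2 * p ≡ 2 * q → p ≡ q
2*-injective {p} {q} = *-cancelˡ-≡ p q 2

1+[2j+1]≡2[1+j] : ∀ j → 1 + (2 * j + 1) ≡ 2 * suc j
1+[2j+1]≡2[1+j] = solve-∀

[2n+1]+[2j+1]≡2[1+n+j] : ∀ n j → (2 * n + 1) + (2 * j + 1) ≡ 2 * suc (n + j)
[2n+1]+[2j+1]≡2[1+n+j] = solve-∀

[2n+1]+2i≡1+2[n+i] : ∀ n i → (2 * n + 1) + 2 * i ≡ suc (2 * (n + i))
[2n+1]+2i≡1+2[n+i] = solve-∀

module _ (n₁ n₂ : ℕ) where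
  private
    s : ℕ
    s = n₁ + n₂

  Hℕ : ℕ → ℕ → Set
  Hℕ u v = EdgeH n₁ n₂ u v ⊎ EdgeH n₁ n₂ v u

  Hℕ-symmetric : ∀ {u v} → Hℕ u v → Hℕ v u
  Hℕ-symmetric (inj₁ e) = inj₂ e
  Hℕ-symmetric (inj₂ e) = inj₁ e

  EdgeH-target-even : ∀ {u v} → EdgeH n₁ n₂ u v → ∃ λ m → v ≡ 2 * m
  EdgeH-target-even (inj₁ (_ , _ , _ , refl , inj₁ (_ , j , _ , _ , _ , refl))) =
    suc j , 1+[2j+1]≡2[1+j] j
  EdgeH-target-even (inj₁ (_ , _ , _ , refl , inj₂ (_ , q , _ , _ , _ , refl))) =
    suc q , 1+[2j+1]≡2[1+j] q
  EdgeH-target-even (inj₂ (inj₁ (_ , _ , _ , refl , inj₁ (_ , j , _ , _ , _ , refl)))) =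
    suc (n₁ + j) , [2n+1]+[2j+1]≡2[1+n+j] n₁ j
  EdgeH-target-even (inj₂ (inj₁ (_ , _ , _ , refl , inj₂ (_ , q , _ , _ , _ , refl)))) =
    suc (n₁ + q) , [2n+1]+[2j+1]≡2[1+n+j] n₁ q
  EdgeH-target-even (inj₂ (inj₂ (_ , q , _ , _ , _ , v≡2q))) = q , v≡2q

  ¬EdgeH-into-odd : ∀ {u a} → ¬ EdgeH n₁ n₂ u (suc (2 * a))
  ¬EdgeH-into-odd {a = a} e with EdgeH-target-even e
  ... | m , v≡2m = even≢odd m a (sym v≡2m)

  ¬Hℕ-odd-odd : ∀ {a b} → ¬ Hℕ (suc (2 * a)) (suc (2 * b))
  ¬Hℕ-odd-odd {b = b} (inj₁ e) = ¬EdgeH-into-odd {a = b} e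
  ¬Hℕ-odd-odd {a = a} (inj₂ e) = ¬EdgeH-into-odd {a = a} e

  Hℕ-evens : ∀ {p q} → p ≢ q → p ≤ s → q ≤ s → Hℕ (2 * p) (2 * q)
  Hℕ-evens {p} {q} p≢q p≤s q≤s with <-cmp p q
  ... | tri< p<q _ _ = inj₁ (inj₂ (inj₂ (p , q , p<q , q≤s , refl , refl)))
  ... | tri≈ _ p≡q _ = contradiction p≡q p≢q
  ... | tri> _ _ q<p = inj₂ (inj₂ (inj₂ (q , p , q<p , p≤s , refl , refl)))

  -- The odd vertex 2a+1 is vertex 2i of a copy of G'; its neighbours are the
  -- vertices 2(k+1), for k running from a to the last index of that copy.
  OddNeighbour : ℕ → ℕ → Set
  OddNeighbour a v = ∃ λ k → a ≤ k × (k < n₁ ⊎ n₁ ≤ a × k < s) × v ≡ 2 * suc k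

  EdgeH-odd⇒OddNeighbour : ∀ {a v} → EdgeH n₁ n₂ (suc (2 * a)) v → OddNeighbour a v
  EdgeH-odd⇒OddNeighbour
    (inj₁ (_ , _ , 1+2a≡1+2i , refl , inj₁ (i , j , i≤j , j<n₁ , refl , refl))) =
    j , subst (_≤ j) (sym (2*-injective (suc-injective 1+2a≡1+2i))) i≤j ,
    inj₁ j<n₁ , 1+[2j+1]≡2[1+j] j
  EdgeH-odd⇒OddNeighbour {a} (inj₁ (_ , _ , eq , _ , inj₂ (p , _ , _ , _ , refl , _))) =
    contradiction (sym (trans eq (1+[2j+1]≡2[1+j] p))) (even≢odd (suc p) a)
  EdgeH-odd⇒OddNeighbour {a}
    (inj₂ (inj₁ (_ , _ , eq , refl , inj₁ (i , j , i≤j , j<n₂ , refl , refl))))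
    with 2*-injective {a} {n₁ + i} (suc-injective (trans eq ([2n+1]+2i≡1+2[n+i] n₁ i)))
  ... | refl = n₁ + j , +-monoʳ-≤ n₁ i≤j , inj₂ (m≤m+n n₁ i , +-monoʳ-< n₁ j<n₂) ,
               [2n+1]+[2j+1]≡2[1+n+j] n₁ j
  EdgeH-odd⇒OddNeighbour {a} (inj₂ (inj₁ (_ , _ , eq , _ , inj₂ (p , _ , _ , _ , refl , _)))) =
    contradiction (sym (trans eq ([2n+1]+[2j+1]≡2[1+n+j] n₁ p))) (even≢odd (suc (n₁ + p)) a)
  EdgeH-odd⇒OddNeighbour {a} (inj₂ (inj₂ (p , _ , _ , _ , eq , _))) =
    contradiction (sym eq) (even≢odd p a)

  OddNeighbour⇒EdgeH-odd : ∀ {a v} → OddNeighbour a v → EdgeH n₁ n₂ (suc (2 * a)) v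
  OddNeighbour⇒EdgeH-odd {a} (k , a≤k , inj₁ k<n₁ , refl) =
    inj₁ (2 * a , 2 * k + 1 , refl , sym (1+[2j+1]≡2[1+j] k) ,
      inj₁ (a , k , a≤k , k<n₁ , refl , refl))
  OddNeighbour⇒EdgeH-odd (k , a≤k , inj₂ (n₁≤a , k<s) , refl)
    with m≤n⇒∃[o]m+o≡n n₁≤a | m≤n⇒∃[o]m+o≡n (≤-trans n₁≤a a≤k)
  ... | i , refl | j , refl =
    inj₂ (inj₁ (2 * i , 2 * j + 1 ,
      sym ([2n+1]+2i≡1+2[n+i] n₁ i) , sym ([2n+1]+[2j+1]≡2[1+n+j] n₁ j) ,
      inj₁ (i , j , +-cancelˡ-≤ n₁ i j a≤k , +-cancelˡ-< n₁ j n₂ k<s , refl , refl)))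

  OddNeighbour-antitone : ∀ {a b v} → b ≤ a → a < n₁ ⊎ n₁ ≤ b →
                          OddNeighbour a v → OddNeighbour b v
  OddNeighbour-antitone b≤a _ (k , a≤k , inj₁ k<n₁ , eq) = k , ≤-trans b≤a a≤k , inj₁ k<n₁ , eq
  OddNeighbour-antitone _ (inj₁ a<n₁) (_ , _ , inj₂ (n₁≤a , _) , _) = contradiction n₁≤a (<⇒≱ a<n₁)
  OddNeighbour-antitone b≤a (inj₂ n₁≤b) (k , a≤k , inj₂ (_ , k<s) , eq) =
    k , ≤-trans b≤a a≤k , inj₂ (n₁≤b , k<s) , eq

  Hℕ-odd-antitone : ∀ {a b v} → b ≤ a → a < n₁ ⊎ n₁ ≤ b →
                    Hℕ (suc (2 * a)) v → Hℕ (suc (2 * b)) v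
  Hℕ-odd-antitone b≤a sameCopy (inj₁ e) =
    inj₁ (OddNeighbour⇒EdgeH-odd (OddNeighbour-antitone b≤a sameCopy (EdgeH-odd⇒OddNeighbour e)))
  Hℕ-odd-antitone {a} _ _ (inj₂ e) = contradiction e (¬EdgeH-into-odd {a = a})

  data Copy (a : ℕ) : Set where
    first  : a < n₁ → Copy a
    second : n₁ ≤ a → Copy a

  data Position : ℕ → Set where
    even : ∀ m → Position (2 * m)
    odd  : ∀ a → Copy a → Position (suc (2 * a))

  position : ∀ v → Position v
  position v with evenOdd v
  ... | even m = even m
  ... | odd a with a <? n₁
  ...   | yes a<n₁ = odd a (first a<n₁)
  ...   | no a≮n₁  = odd a (second (≮⇒≥ a≮n₁))

  level : ∀ {v} → Position v → ℕ
  level (even _)           = s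
  level (odd a (first _))  = suc (s + a)
  level (odd a (second _)) = s ∸ a

  height : ℕ → ℕ
  height = level ∘ position

  vertex≤2s : ∀ {v} → v < 2 * s + 1 → v ≤ 2 * s
  vertex≤2s {v} v< = m<1+n⇒m≤n (subst (v <_) (+-comm (2 * s) 1) v<)

  even-vertex-bound : ∀ {m} → 2 * m < 2 * s + 1 → m ≤ s
  even-vertex-bound = *-cancelˡ-≤ 2 ∘ vertex≤2s

  odd-vertex-bound : ∀ {a} → suc (2 * a) < 2 * s + 1 → a ≤ s
  odd-vertex-bound {a} = <⇒≤ ∘ *-cancelˡ-< 2 a s ∘ vertex≤2s

  centre<first : ∀ a → s < suc (s + a)
  centre<first a = s≤s (m≤m+n s a)

  second<centre : 1 ≤ n₁ → ∀ {a} → n₁ ≤ a → a ≤ s → s ∸ a < s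
  second<centre 1≤n₁ n₁≤a a≤s = ∸-monoʳ-< (≤-trans 1≤n₁ n₁≤a) a≤s

  second<first : ∀ a b → s ∸ b < suc (s + a)
  second<first a b = ≤-<-trans (m∸n≤m s b) (centre<first a)

  height-separates : 1 ≤ n₁ → ∀ {u v} → u < 2 * s + 1 → v < 2 * s + 1 →
                     u ≢ v → ¬ Hℕ u v → height u ≢ height v
  height-separates 1≤n₁ {u} {v} u< v< u≢v u≁v with position u | position v
  ... | even p | even q = λ _ →
    u≁v (Hℕ-evens (u≢v ∘ cong (2 *_)) (even-vertex-bound {p} u<) (even-vertex-bound {q} v<))
  ... | even _ | odd b (first _) = <⇒≢ (centre<first b)
  ... | even _ | odd b (second n₁≤b) = >⇒≢ (second<centre 1≤n₁ n₁≤b (odd-vertex-bound v<))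
  ... | odd a (first _) | even _ = >⇒≢ (centre<first a)
  ... | odd a (second n₁≤a) | even _ = <⇒≢ (second<centre 1≤n₁ n₁≤a (odd-vertex-bound u<))
  ... | odd a (first _) | odd b (first _) =
    u≢v ∘ cong (suc ∘ (2 *_)) ∘ +-cancelˡ-≡ s a b ∘ suc-injective
  ... | odd a (second _) | odd b (second _) =
    u≢v ∘ cong (suc ∘ (2 *_)) ∘ ∸-cancelˡ-≡ (odd-vertex-bound {a} u<) (odd-vertex-bound {b} v<)
  ... | odd a (first _) | odd b (second _) = >⇒≢ (second<first a b)
  ... | odd a (second _) | odd b (first _) = <⇒≢ (second<first b a)

  height-transitive : ∀ {u v w} → ¬ Hℕ u v → ¬ Hℕ v w →
                      height u < height v → height v < height w → ¬ Hℕ u w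
  height-transitive {u} {v} {w} u≁v v≁w hu<hv hv<hw with position u | position w
  ... | odd a _ | odd c _ = ¬Hℕ-odd-odd {a} {c}
  ... | even _ | even _ = contradiction hv<hw (<-asym hu<hv)
  ... | even _ | odd c w-copy with position v
  ...   | even _ = contradiction hu<hv (<-irrefl refl)
  ...   | odd b (second _) = contradiction hu<hv (≤⇒≯ (m∸n≤m s b))
  ...   | odd b (first _) with w-copy
  ...     | second _ = contradiction hv<hw (<⇒≯ (second<first b c))
  ...     | first c<n₁ =
    u≁v ∘ Hℕ-symmetric ∘ Hℕ-odd-antitone b≤c (inj₁ c<n₁) ∘ Hℕ-symmetric
    where
    b≤c : b ≤ c
    b≤c = <⇒≤ (+-cancelˡ-< s b c (s<s⁻¹ hv<hw))
  height-transitive {u} {v} {w} u≁v v≁w hu<hv hv<hw | odd a u-copy | even _ with position v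
  ...   | even _ = contradiction hv<hw (<-irrefl refl)
  ...   | odd b (first _) = contradiction hv<hw (<⇒≯ (centre<first b))
  ...   | odd b (second n₁≤b) with u-copy
  ...     | first _ = contradiction hu<hv (<⇒≯ (second<first a b))
  ...     | second _ = v≁w ∘ Hℕ-odd-antitone (<⇒≤ (∸-cancelʳ-< {a} {b} hu<hv)) (inj₂ n₁≤b)

isComparability-complement-H : ∀ n₁ n₂ → 1 ≤ n₁ → IsComparability (complement (H n₁ n₂))
isComparability-complement-H n₁ n₂ 1≤n₁ =
  isComparability-byHeight Hᶜ (complement-symmetric (Hℕ-symmetric n₁ n₂)) h separates transitive
  where
  Hᶜ : Graph (2 * (n₁ + n₂) + 1)
  Hᶜ = complement (H n₁ n₂)

  h : Fin (2 * (n₁ + n₂) + 1) → ℕ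
  h = height n₁ n₂ ∘ toℕ

  separates : ∀ {u v} → Hᶜ u v → h u ≢ h v
  separates {u} {v} (u≢v , u≁v) =
    height-separates n₁ n₂ 1≤n₁ (toℕ<n u) (toℕ<n v) (u≢v ∘ toℕ-injective) u≁v

  transitive : ∀ {u v w} → Hᶜ u v → Hᶜ v w → h u < h v → h v < h w → Hᶜ u w
  transitive (_ , u≁v) (_ , v≁w) hu<hv hv<hw =
    (λ { refl → <-asym hu<hv hv<hw }) , height-transitive n₁ n₂ u≁v v≁w hu<hv hv<hw

mainTheorem7 : (n₁ n₂ : ℕ) → 1 ≤ n₁ → 1 ≤ n₂ →
    IsComparability (complement (H n₁ n₂)) ⇔ (¬ HasInducedCopy G₃ (H n₁ n₂))
mainTheorem7 n₁ n₂ 1≤n₁ _ =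
  mk⇔ isComparability-complement⇒¬G₃ (λ _ → isComparability-complement-H n₁ n₂ 1≤n₁)
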